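{- Let $\varphi$ be a set of index variables and $\Phi$ a set of constraints on $\varphi$. If $\varphi;\Phi\vDash B_o\subseteq A_o$ for intervals $A_o,B_o$, then for every usage $U$, $\varphi;\Phi\vdash\uparrow^{A_o}U\sqsubseteq\uparrow^{B_o}U$.
   Context: INDICES. Index variables $i,j,k$; indices $I::=\tilde I\mid\infty$, $\tilde I::=i\mid f(\tilde I,\dots,\tilde I)$, with function symbols (natural constants, $+$, $\times$, truncated subtraction) interpreted on $\mathbb{N}$; values in $\mathbb{N}\cup\{\infty\}$, $\infty+J=\infty$. Constraints $I\bowtie J$ with $\bowtie\in\{\le,<,=,\ne\}$; $\varphi;\Phi\vDash C$ means every valuation of $\varphi$ into $\mathbb{N}$ satisfying $\Phi$ satisfies $C$; $\varphi;\Phi\vDash[I,J]\subseteq[I',J']$ means $I'\le I$ and $J\le J'$ are entailed. USAGES. $U,V::=0\mid(U\mid V)\mid\mathsf{in}^{A_o}_{J_c}.U\mid\mathsf{out}^{A_o}_{J_c}.U\mid!U\mid U+V$; obligations $A_o$ intervals; capacities $J_c$ a single index $J$ (read $[-\infty,J]$) or an interval. $\alpha^{A_o}_{J_c}$ denotes either prefix. Congruence $\equiv$: least congruence with $U\mid0\equiv U$, commutativity and associativity of $\mid$, $!0\equiv0$, $!U\equiv!U\mid U$, $!(U\mid V)\equiv!U\mid!V$, $!!U\equiv!U$. $[I,J]+[I',J']=[I+I',J+J']$, $[I,J]+J'=[I,J+J']$. Delay: $\uparrow^A0=0$, $\uparrow^A(U\mid V)=\uparrow^AU\mid\uparrow^AV$,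 $\uparrow^A(U+V)=\uparrow^AU+\uparrow^AV$, $\uparrow^A(!U)=!(\uparrow^AU)$, $\uparrow^A\alpha^{B_o}_{J_c}.U=\alpha^{A+B_o}_{J_c}.U$. Subusage $\varphi;\Phi\vdash U\sqsubseteq V$: least relation closed under $U\sqsubseteq0$; $U_1+U_2\sqsubseteq U_i$; if $U\sqsubseteq U'$ then $U+V\sqsubseteq U'+V$, $V+U\sqsubseteq V+U'$, $U\mid V\sqsubseteq U'\mid V$, $!U\sqsubseteq!U'$, $\alpha^{A_o}_{J_c}.U\sqsubseteq\alpha^{A_o}_{J_c}.U'$; closure under $\equiv$ on both sides; transitivity; $\alpha^{A_o}_{I_c}.U\sqsubseteq\alpha^{B_o}_{J_c}.U$ whenever $\varphi;\Phi\vDash B_o\subseteq A_o$ and $I_c\le J_c$ (interval inclusion, a single index $J$ read as $[-\infty,J]$); and $(\alpha^{A_o}_{J_c}.U)\mid(\uparrow^{A_o+J_c}V)\sqsubseteq\alpha^{A_o}_{J_c}.(U\mid V)$. -}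

module Defs where

open import Data.Nat using (ℕ; _+_; _*_; _∸_) renaming (_≤_ to _≤ℕ_; _<_ to _<ℕ_)
open import Data.Fin using (Fin)
open import Data.List using (List)
open import Data.List.Relation.Unary.All using (All)
open import Data.Product using (_×_)
open import Data.Unit using (⊤)
open import Data.Empty using (⊥)
open import Relation.Binary.PropositionalEquality using (_≡_)
open import Relation.Nullary using (¬_)

-- Indices.  The set φ of index variables is Fin n.

data FIdx (n : ℕ) : Set where
  var  : Fin n → FIdx n
  cst  : ℕ → FIdx n
  _⊕_  : FIdx n → FIdx n → FIdx n
  _⊗_  : FIdx n → FIdx n → FIdx n
  _⊖_  : FIdx n → FIdx n → FIdx n   -- truncated subtraction

data Idx (n : ℕ) : Set where
  fin : FIdx n → Idx n
  ∞   : Idx n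

_+ᵢ_ : ∀ {n} → Idx n → Idx n → Idx n
fin I +ᵢ fin J = fin (I ⊕ J)
fin _ +ᵢ ∞     = ∞
∞     +ᵢ _     = ∞

data Val : Set where
  nat : ℕ → Val
  ∞v  : Val

Valuation : ℕ → Set
Valuation n = Fin n → ℕ

⟦_⟧ᶠ : ∀ {n} → FIdx n → Valuation n → ℕ
⟦ var i ⟧ᶠ ρ = ρ i
⟦ cst c ⟧ᶠ ρ = c
⟦ I ⊕ J ⟧ᶠ ρ = ⟦ I ⟧ᶠ ρ + ⟦ J ⟧ᶠ ρ
⟦ I ⊗ J ⟧ᶠ ρ = ⟦ I ⟧ᶠ ρ * ⟦ J ⟧ᶠ ρ
⟦ I ⊖ J ⟧ᶠ ρ = ⟦ I ⟧ᶠ ρ ∸ ⟦ J ⟧ᶠ ρ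

⟦_⟧ : ∀ {n} → Idx n → Valuation n → Val
⟦ fin I ⟧ ρ = nat (⟦ I ⟧ᶠ ρ)
⟦ ∞ ⟧     ρ = ∞v

_≤v_ : Val → Val → Set
nat m ≤v nat k = m ≤ℕ k
nat _ ≤v ∞v    = ⊤
∞v    ≤v nat _ = ⊥
∞v    ≤v ∞v    = ⊤

_<v_ : Val → Val → Set
nat m <v nat k = m <ℕ k
nat _ <v ∞v    = ⊤
∞v    <v _     = ⊥

data Con (n : ℕ) : Set where
  _≤c_ _<c_ _=c_ _≠c_ : Idx n → Idx n → Con n

SatC : ∀ {n} → Valuation n → Con n → Set
SatC ρ (I ≤c J) = ⟦ I ⟧ ρ ≤v ⟦ J ⟧ ρ
SatC ρ (I <c J) = ⟦ I ⟧ ρ <v ⟦ J ⟧ ρ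
SatC ρ (I =c J) = ⟦ I ⟧ ρ ≡ ⟦ J ⟧ ρ
SatC ρ (I ≠c J) = ¬ (⟦ I ⟧ ρ ≡ ⟦ J ⟧ ρ)

_⊨_ : ∀ {n} → List (Con n) → Con n → Set
_⊨_ {n} Φ C = (ρ : Valuation n) → All (SatC ρ) Φ → SatC ρ C

-- φ;Φ ⊨ −∞ ≥ c  (no valuation satisfies Φ), used for capacities [−∞,J]
⊨⊥ : ∀ {n} → List (Con n) → Set
⊨⊥ {n} Φ = (ρ : Valuation n) → All (SatC ρ) Φ → ⊥

record Intv (n : ℕ) : Set where
  constructor [_,_]
  field lo hi : Idx n
open Intv public

_⊨_⊆_ : ∀ {n} → List (Con n) → Intv n → Intv n → Set
Φ ⊨ [ I , J ] ⊆ [ I' , J' ] = (Φ ⊨ (I' ≤c I)) × (Φ ⊨ (J ≤c J'))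

-- capacities: a single index J (read [−∞,J]) or an interval
data Cap (n : ℕ) : Set where
  single : Idx n → Cap n
  intv   : Intv n → Cap n

-- capacity ordering I_c ≤ J_c : interval inclusion I_c ⊆ J_c,
-- a single index J being read as [−∞,J]
_⊨_≤cap_ : ∀ {n} → List (Con n) → Cap n → Cap n → Set
Φ ⊨ single I          ≤cap single J          = Φ ⊨ (I ≤c J)
Φ ⊨ intv [ _ , I ]    ≤cap single J          = Φ ⊨ (I ≤c J)
Φ ⊨ single I          ≤cap intv [ L' , J ]   = ⊨⊥ Φ × (Φ ⊨ (I ≤c J))
Φ ⊨ intv [ L , I ]    ≤cap intv [ L' , J ]   = (Φ ⊨ (L' ≤c L)) × (Φ ⊨ (I ≤c J))

_+ᵒ_ : ∀ {n} → Intv n → Intv n → Intv n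
[ I , J ] +ᵒ [ I' , J' ] = [ I +ᵢ I' , J +ᵢ J' ]

_+ᶜ_ : ∀ {n} → Intv n → Cap n → Intv n
[ I , J ] +ᶜ single J' = [ I , J +ᵢ J' ]
A         +ᶜ intv B    = A +ᵒ B

data Pol : Set where
  inP outP : Pol

data Usage (n : ℕ) : Set where
  𝟘    : Usage n
  _∣_  : Usage n → Usage n → Usage n
  act  : Pol → Intv n → Cap n → Usage n → Usage n
  !_   : Usage n → Usage n
  _⊞_  : Usage n → Usage n → Usage n

infixr 6 _⊞_
infixr 7 _∣_

↑ : ∀ {n} → Intv n → Usage n → Usage n
↑ A 𝟘             = 𝟘
↑ A (U ∣ V)       = ↑ A U ∣ ↑ A V
↑ A (U ⊞ V)       = ↑ A U ⊞ ↑ A V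
↑ A (! U)         = ! (↑ A U)
↑ A (act α B c U) = act α (A +ᵒ B) c U

data _≅_ {n : ℕ} : Usage n → Usage n → Set where
  refl≅  : ∀ {U} → U ≅ U
  sym≅   : ∀ {U V} → U ≅ V → V ≅ U
  trans≅ : ∀ {U V W} → U ≅ V → V ≅ W → U ≅ W
  cong∣  : ∀ {U U' V V'} → U ≅ U' → V ≅ V' → (U ∣ V) ≅ (U' ∣ V')
  cong⊞  : ∀ {U U' V V'} → U ≅ U' → V ≅ V' → (U ⊞ V) ≅ (U' ⊞ V')
  cong!  : ∀ {U U'} → U ≅ U' → (! U) ≅ (! U')
  congα  : ∀ {α A c U U'} → U ≅ U' → act α A c U ≅ act α A c U'
  ∣𝟘     : ∀ {U} → (U ∣ 𝟘) ≅ U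
  ∣comm  : ∀ {U V} → (U ∣ V) ≅ (V ∣ U)
  ∣assoc : ∀ {U V W} → ((U ∣ V) ∣ W) ≅ (U ∣ (V ∣ W))
  !𝟘     : (! 𝟘) ≅ 𝟘
  !unf   : ∀ {U} → (! U) ≅ ((! U) ∣ U)
  !∣     : ∀ {U V} → (! (U ∣ V)) ≅ ((! U) ∣ (! V))
  !!     : ∀ {U} → (! (! U)) ≅ (! U)

data _⊢_⊑_ {n : ℕ} (Φ : List (Con n)) : Usage n → Usage n → Set where
  ⊑𝟘     : ∀ {U} → Φ ⊢ U ⊑ 𝟘
  ⊑⊞ˡ    : ∀ {U₁ U₂} → Φ ⊢ (U₁ ⊞ U₂) ⊑ U₁
  ⊑⊞ʳ    : ∀ {U₁ U₂} → Φ ⊢ (U₁ ⊞ U₂) ⊑ U₂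
  ⊑ctx⊞ˡ : ∀ {U U' V} → Φ ⊢ U ⊑ U' → Φ ⊢ (U ⊞ V) ⊑ (U' ⊞ V)
  ⊑ctx⊞ʳ : ∀ {U U' V} → Φ ⊢ U ⊑ U' → Φ ⊢ (V ⊞ U) ⊑ (V ⊞ U')
  ⊑ctx∣  : ∀ {U U' V} → Φ ⊢ U ⊑ U' → Φ ⊢ (U ∣ V) ⊑ (U' ∣ V)
  ⊑ctx!  : ∀ {U U'} → Φ ⊢ U ⊑ U' → Φ ⊢ (! U) ⊑ (! U')
  ⊑ctxα  : ∀ {α A c U U'} → Φ ⊢ U ⊑ U' → Φ ⊢ act α A c U ⊑ act α A c U'
  ⊑≅     : ∀ {U U' V' V} → U ≅ U' → Φ ⊢ U' ⊑ V' → V' ≅ V → Φ ⊢ U ⊑ V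
  ⊑trans : ∀ {U V W} → Φ ⊢ U ⊑ V → Φ ⊢ V ⊑ W → Φ ⊢ U ⊑ W
  ⊑act   : ∀ {α A B I J U} → Φ ⊨ B ⊆ A → Φ ⊨ I ≤cap J →
           Φ ⊢ act α A I U ⊑ act α B J U
  ⊑delay : ∀ {α A J U V} →
           Φ ⊢ (act α A J U ∣ ↑ (A +ᶜ J) V) ⊑ act α A J (U ∣ V)

module Submission where

open import Defs
open import Data.Nat using (ℕ)
open import Data.List using (List)
open import Data.Product using (_,_)
open import Data.Unit using (tt)
open import Data.Nat.Properties using (≤-refl; +-monoˡ-≤)

≤v-refl : ∀ v → v ≤v v
≤v-refl (nat m) = ≤-refl
≤v-refl ∞v      = tt

+ᵢ-monoˡ-≤v : ∀ {n} (ρ : Valuation n) (I J K : Idx n) →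
  ⟦ I ⟧ ρ ≤v ⟦ J ⟧ ρ → ⟦ I +ᵢ K ⟧ ρ ≤v ⟦ J +ᵢ K ⟧ ρ
+ᵢ-monoˡ-≤v ρ (fin I) (fin J) (fin K) I≤J = +-monoˡ-≤ (⟦ K ⟧ᶠ ρ) I≤J
+ᵢ-monoˡ-≤v ρ (fin I) (fin J) ∞       _   = tt
+ᵢ-monoˡ-≤v ρ (fin I) ∞       (fin K) _   = tt
+ᵢ-monoˡ-≤v ρ (fin I) ∞       ∞       _   = tt
+ᵢ-monoˡ-≤v ρ ∞       ∞       K       _   = tt

module _ {n : ℕ} (Φ : List (Con n)) where

  ⊨-≤-refl : (I : Idx n) → Φ ⊨ (I ≤c I)
  ⊨-≤-refl I ρ _ = ≤v-refl (⟦ I ⟧ ρ)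

  ⊨-+ᵢ-monoˡ-≤ : (I J K : Idx n) → Φ ⊨ (I ≤c J) → Φ ⊨ ((I +ᵢ K) ≤c (J +ᵢ K))
  ⊨-+ᵢ-monoˡ-≤ I J K I≤J ρ sat = +ᵢ-monoˡ-≤v ρ I J K (I≤J ρ sat)

  +ᵒ-monoˡ-⊆ : (A B C : Intv n) → Φ ⊨ B ⊆ A → Φ ⊨ (B +ᵒ C) ⊆ (A +ᵒ C)
  +ᵒ-monoˡ-⊆ [ a , a' ] [ b , b' ] [ c , c' ] (a≤b , b'≤a') =
    ⊨-+ᵢ-monoˡ-≤ a b c a≤b , ⊨-+ᵢ-monoˡ-≤ b' a' c' b'≤a'

  ≤cap-refl : (c : Cap n) → Φ ⊨ c ≤cap c
  ≤cap-refl (single I)       = ⊨-≤-refl I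
  ≤cap-refl (intv [ L , I ]) = ⊨-≤-refl L , ⊨-≤-refl I

  ⊑ctx∣ʳ : ∀ {U V V'} → Φ ⊢ V ⊑ V' → Φ ⊢ (U ∣ V) ⊑ (U ∣ V')
  ⊑ctx∣ʳ V⊑V' = ⊑≅ ∣comm (⊑ctx∣ V⊑V') ∣comm

  ⊑-∣ : ∀ {U U' V V'} → Φ ⊢ U ⊑ U' → Φ ⊢ V ⊑ V' → Φ ⊢ (U ∣ V) ⊑ (U' ∣ V')
  ⊑-∣ U⊑U' V⊑V' = ⊑trans (⊑ctx∣ U⊑U') (⊑ctx∣ʳ V⊑V')

  ⊑-⊞ : ∀ {U U' V V'} → Φ ⊢ U ⊑ U' → Φ ⊢ V ⊑ V' → Φ ⊢ (U ⊞ V) ⊑ (U' ⊞ V')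
  ⊑-⊞ U⊑U' V⊑V' = ⊑trans (⊑ctx⊞ˡ U⊑U') (⊑ctx⊞ʳ V⊑V')

  ↑-mono-⊑ : (A B : Intv n) → Φ ⊨ B ⊆ A → (U : Usage n) → Φ ⊢ ↑ A U ⊑ ↑ B U
  ↑-mono-⊑ A B B⊆A 𝟘             = ⊑𝟘
  ↑-mono-⊑ A B B⊆A (U ∣ V)       = ⊑-∣ (↑-mono-⊑ A B B⊆A U) (↑-mono-⊑ A B B⊆A V)
  ↑-mono-⊑ A B B⊆A (U ⊞ V)       = ⊑-⊞ (↑-mono-⊑ A B B⊆A U) (↑-mono-⊑ A B B⊆A V)
  ↑-mono-⊑ A B B⊆A (! U)         = ⊑ctx! (↑-mono-⊑ A B B⊆A U)
  ↑-mono-⊑ A B B⊆A (act α C c U) = ⊑act (+ᵒ-monoˡ-⊆ A B C B⊆A) (≤cap-refl c)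

mainTheorem10 : (n : ℕ) (Φ : List (Con n)) (A B : Intv n) →
    Φ ⊨ B ⊆ A → (U : Usage n) → Φ ⊢ ↑ A U ⊑ ↑ B U
mainTheorem10 n Φ = ↑-mono-⊑ Φ
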